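{- Let $G=(V,E)$ be a finite simple connected graph of order $n\geq 2$. Then $\alpha_0(S(G)) = n-\beta^*_0(G)$.
   Context: For a finite simple graph $G=(V,E)$, the splitting graph $S(G)$ is obtained from $G$ by adding, for each vertex $v\in V$, a new vertex $v'$, and joining $v'$ to a vertex $u\in V$ if and only if $uv\in E$ (no other edges are added). $\alpha_0(H)$ denotes the vertex cover number of a graph $H$ (minimum size of a set of vertices meeting every edge). For $S\subseteq V$, $N(S)$ is the set of vertices of $G$ adjacent to at least one vertex of $S$. Define $\beta_0^*(G):=\max\{|S|-|N(S)| : S \text{ is an independent set of } G\}$ (the empty set counts as independent). -}

module Defs where

open import Data.Nat using (ℕ; _+_)
open import Data.Bool using (Bool; true; false; _∧_)
open import Data.Fin using (Fin; splitAt)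
open import Data.Fin.Subset using (Subset; _∈_; ∣_∣)
open import Data.Vec using (tabulate; lookup)
open import Data.List using (allFin)
open import Data.Bool.ListAction using (any)
open import Data.Sum using (_⊎_; inj₁; inj₂)
open import Data.Product using (Σ; _×_)
open import Data.Integer using (ℤ; +_; _-_; _≤_)
open import Relation.Binary.PropositionalEquality using (_≡_)
open import Relation.Binary.Construct.Closure.ReflexiveTransitive using (Star)

record Graph (n : ℕ) : Set where
  field
    adj     : Fin n → Fin n → Bool
    symm    : ∀ u v → adj u v ≡ adj v u
    irrefl  : ∀ v → adj v v ≡ false
open Graph public

Edge : ∀ {n} → Graph n → Fin n → Fin n → Set
Edge G u v = adj G u v ≡ true

Connected : ∀ {n} → Graph n → Set
Connected G = ∀ u v → Star (Edge G) u v

-- splitting graph S(G) on Fin (n + n): the first n vertices are the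
-- original vertices v, the last n are the copies v'.
-- u ~ v  iff uv ∈ E;  u ~ v'  iff  v' ~ u  iff uv ∈ E;  u' ≁ v'.
splitAdj : ∀ {n} → Graph n → Fin (n + n) → Fin (n + n) → Bool
splitAdj {n} G x y with splitAt n x | splitAt n y
... | inj₁ u | inj₁ v = adj G u v
... | inj₁ u | inj₂ v = adj G u v
... | inj₂ u | inj₁ v = adj G u v
... | inj₂ u | inj₂ v = false

splitSymm : ∀ {n} (G : Graph n) x y → splitAdj G x y ≡ splitAdj G y x
splitSymm {n} G x y with splitAt n x | splitAt n y
... | inj₁ u | inj₁ v = symm G u v
... | inj₁ u | inj₂ v = symm G u v
... | inj₂ u | inj₁ v = symm G u v
... | inj₂ u | inj₂ v = Relation.Binary.PropositionalEquality.refl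

splitIrrefl : ∀ {n} (G : Graph n) x → splitAdj G x x ≡ false
splitIrrefl {n} G x with splitAt n x
... | inj₁ u = irrefl G u
... | inj₂ u = Relation.Binary.PropositionalEquality.refl

SplittingGraph : ∀ {n} → Graph n → Graph (n + n)
SplittingGraph G = record
  { adj = splitAdj G ; symm = splitSymm G ; irrefl = splitIrrefl G }

IsVertexCover : ∀ {m} → Graph m → Subset m → Set
IsVertexCover H C = ∀ u v → Edge H u v → (u ∈ C) ⊎ (v ∈ C)

IsVertexCoverNumber : ∀ {m} → Graph m → ℕ → Set
IsVertexCoverNumber H k =
  Σ (Subset _) (λ C → IsVertexCover H C × ∣ C ∣ ≡ k)
  × (∀ C → IsVertexCover H C → k Data.Nat.≤ ∣ C ∣)

IsIndependent : ∀ {n} → Graph n → Subset n → Set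
IsIndependent G S = ∀ u v → u ∈ S → v ∈ S → adj G u v ≡ false

N : ∀ {n} → Graph n → Subset n → Subset n
N {n} G S = tabulate (λ v → any (λ u → lookup S u ∧ adj G u v) (allFin n))

IsBetaStar : ∀ {n} → Graph n → ℤ → Set
IsBetaStar G b =
  Σ (Subset _) (λ S → IsIndependent G S × (+ ∣ S ∣ - + ∣ N G S ∣) ≡ b)
  × (∀ S → IsIndependent G S → (+ ∣ S ∣ - + ∣ N G S ∣) ≤ b)

-- A subset of S(G) splits as X ++ Y, X on the original vertices and Y on the
-- copies v'. It is a vertex cover exactly when V ∖ X is independent (edges
-- inside V) and N(V ∖ X) ⊆ Y (an edge u v' with u ∉ X must be covered by v').
-- Taking X = V ∖ S and Y = N(S) for independent S gives a cover of size
-- n − (|S| − |N(S)|), and every cover has size at least n − (|A| − |N(A)|) for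
-- the independent set A = V ∖ X. Hence α₀(S(G)) = n − β₀*(G).
module Submission where

open import Defs
open import Data.Nat using (ℕ; _≤_)
open import Data.Integer using (ℤ; +_; _-_)
open import Relation.Binary.PropositionalEquality using (_≡_)

open import Data.Bool using (true; false; T; _∧_)
open import Data.Bool.Properties using (T-≡; T-∧)
open import Data.Empty using (⊥-elim)
open import Data.Fin using (splitAt; _↑ˡ_; _↑ʳ_)
open import Data.Fin.Properties using (splitAt-↑ˡ; splitAt-↑ʳ; splitAt⁻¹-↑ˡ; splitAt⁻¹-↑ʳ)
open import Data.Fin.Subset using (Subset; _∈_; _⊆_; ∁; ∣_∣; inside; outside)
open import Data.Fin.Subset.Properties using (_∈?_; x∈∁p⇒x∉p; x∉p⇒x∈∁p; ∣∁p∣≡n∸∣p∣; ∣p∣≤n; p⊆q⇒∣p∣≤∣q∣)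
open import Data.Integer.Properties using (pos-+; m-n≡m⊖n; ⊖-≥; +-monoʳ-≤; neg-mono-≤; ≤-antisym; module ≤-Reasoning)
open import Data.Integer.Solver using (module +-*-Solver)
open import Data.List using (allFin)
open import Data.Bool.ListAction using (any)
open import Data.List.Membership.Propositional using (lose)
open import Data.List.Membership.Propositional.Properties using (∈-allFin)
open import Data.List.Relation.Unary.Any using (satisfied)
open import Data.List.Relation.Unary.Any.Properties using (any⁺; any⁻)
open import Data.Product using (_×_; _,_; proj₁; proj₂; ∃-syntax)
open import Data.Sum using (_⊎_; inj₁; inj₂)
import Data.Sum as Sum
open import Data.Vec using (_∷_; []; _++_; lookup)
import Data.Vec as Vec
open import Data.Vec.Properties using ([]=⇒lookup; lookup⇒[]=; lookup∘tabulate; lookup-++ˡ; lookup-++ʳ)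
open import Relation.Nullary using (¬_; yes; no)
open import Function using (Equivalence; _⇔_; mk⇔)
open import Relation.Binary.PropositionalEquality using (refl; sym; trans; cong; subst; module ≡-Reasoning)
import Data.Integer as ℤ
import Data.Nat as ℕ

open Equivalence using (to; from)

∈⇔lookup≡inside : ∀ {n} {p : Subset n} {i} → i ∈ p ⇔ lookup p i ≡ inside
∈⇔lookup≡inside {p = p} {i} = mk⇔ []=⇒lookup (lookup⇒[]= i p)

↑ˡ∈++⇔ : ∀ {m k} {p : Subset m} {q : Subset k} {i} → (i ↑ˡ k) ∈ p ++ q ⇔ i ∈ p
↑ˡ∈++⇔ {p = p} {q} {i} = mk⇔
  (λ h → ∈⇔lookup≡inside .from (trans (sym (lookup-++ˡ p q i)) (∈⇔lookup≡inside .to h)))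
  (λ h → ∈⇔lookup≡inside .from (trans (lookup-++ˡ p q i) (∈⇔lookup≡inside .to h)))

↑ʳ∈++⇔ : ∀ {m k} {p : Subset m} {q : Subset k} {i} → (m ↑ʳ i) ∈ p ++ q ⇔ i ∈ q
↑ʳ∈++⇔ {m} {p = p} {q} {i} = mk⇔
  (λ h → ∈⇔lookup≡inside .from (trans (sym (lookup-++ʳ p q i)) (∈⇔lookup≡inside .to h)))
  (λ h → ∈⇔lookup≡inside .from (trans (lookup-++ʳ p q i) (∈⇔lookup≡inside .to h)))

∣p++q∣≡∣p∣+∣q∣ : ∀ {m k} (p : Subset m) (q : Subset k) → ∣ p ++ q ∣ ≡ ∣ p ∣ ℕ.+ ∣ q ∣
∣p++q∣≡∣p∣+∣q∣ []            q = refl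
∣p++q∣≡∣p∣+∣q∣ (inside  ∷ p) q = cong ℕ.suc (∣p++q∣≡∣p∣+∣q∣ p q)
∣p++q∣≡∣p∣+∣q∣ (outside ∷ p) q = ∣p++q∣≡∣p∣+∣q∣ p q

splitAt≡inj₁⇒∈++ : ∀ {m k} {p : Subset m} {q : Subset k} {x u} →
                    splitAt m x ≡ inj₁ u → u ∈ p → x ∈ p ++ q
splitAt≡inj₁⇒∈++ {p = p} {q} x≡u u∈p = subst (_∈ p ++ q) (splitAt⁻¹-↑ˡ x≡u) (↑ˡ∈++⇔ .from u∈p)

splitAt≡inj₂⇒∈++ : ∀ {m k} {p : Subset m} {q : Subset k} {x u} →
                    splitAt m x ≡ inj₂ u → u ∈ q → x ∈ p ++ q
splitAt≡inj₂⇒∈++ {p = p} {q} x≡u u∈q = subst (_∈ p ++ q) (splitAt⁻¹-↑ʳ x≡u) (↑ʳ∈++⇔ .from u∈q)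

+∣∁p∣≡n-∣p∣ : ∀ {n} (p : Subset n) → + ∣ ∁ p ∣ ≡ + n - + ∣ p ∣
+∣∁p∣≡n-∣p∣ {n} p = begin
  + ∣ ∁ p ∣          ≡⟨ cong +_ (∣∁p∣≡n∸∣p∣ p) ⟩
  + (n ℕ.∸ ∣ p ∣)    ≡⟨ ⊖-≥ (∣p∣≤n p) ⟨
  n ℤ.⊖ ∣ p ∣        ≡⟨ m-n≡m⊖n n ∣ p ∣ ⟨
  + n - + ∣ p ∣      ∎
  where open ≡-Reasoning

module _ {n} (G : Graph n) where

  ∈N⇔T-any : ∀ {S v} → v ∈ N G S ⇔ T (any (λ u → lookup S u ∧ adj G u v) (allFin n))
  ∈N⇔T-any {S} {v} = mk⇔
    (λ h → T-≡ .from (trans (sym (lookup∘tabulate _ v)) (∈⇔lookup≡inside .to h)))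
    (λ h → ∈⇔lookup≡inside .from (trans (lookup∘tabulate _ v) (T-≡ .to h)))

  ∈-N⁺ : ∀ {S u v} → u ∈ S → Edge G u v → v ∈ N G S
  ∈-N⁺ {S} {u} u∈S uv = ∈N⇔T-any {S} .from
    (any⁺ _ (lose (∈-allFin u) (T-∧ .from (T-≡ .from (∈⇔lookup≡inside .to u∈S) , T-≡ .from uv))))

  ∈-N⁻ : ∀ {S v} → v ∈ N G S → ∃[ u ] u ∈ S × Edge G u v
  ∈-N⁻ {S} v∈NS with satisfied (any⁻ _ (allFin n) (∈N⇔T-any {S} .to v∈NS))
  ... | u , Su∧uv with T-∧ .to Su∧uv
  ...   | Su , uv = u , ∈⇔lookup≡inside .from (T-≡ .to Su) , T-≡ .to uv

  IsSplitCover : Subset n → Subset n → Set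
  IsSplitCover X Y = ∀ {u v} → Edge G u v → (u ∈ X ⊎ v ∈ X) × (u ∈ X ⊎ v ∈ Y)

  splitAdj-↑ˡ-↑ˡ : ∀ u v → splitAdj G (u ↑ˡ n) (v ↑ˡ n) ≡ adj G u v
  splitAdj-↑ˡ-↑ˡ u v rewrite splitAt-↑ˡ n u n | splitAt-↑ˡ n v n = refl

  splitAdj-↑ˡ-↑ʳ : ∀ u v → splitAdj G (u ↑ˡ n) (n ↑ʳ v) ≡ adj G u v
  splitAdj-↑ˡ-↑ʳ u v rewrite splitAt-↑ˡ n u n | splitAt-↑ʳ n n v = refl

  vertexCover⇒isSplitCover : ∀ {X Y} → IsVertexCover (SplittingGraph G) (X ++ Y) → IsSplitCover X Y
  vertexCover⇒isSplitCover cover {u} {v} uv =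
    Sum.map (↑ˡ∈++⇔ .to) (↑ˡ∈++⇔ .to) (cover (u ↑ˡ n) (v ↑ˡ n) (trans (splitAdj-↑ˡ-↑ˡ u v) uv)) ,
    Sum.map (↑ˡ∈++⇔ .to) (↑ʳ∈++⇔ .to) (cover (u ↑ˡ n) (n ↑ʳ v) (trans (splitAdj-↑ˡ-↑ʳ u v) uv))

  isSplitCover⇒vertexCover : ∀ {X Y} → IsSplitCover X Y → IsVertexCover (SplittingGraph G) (X ++ Y)
  isSplitCover⇒vertexCover cover x y xy with splitAt n x in x≡u | splitAt n y in y≡v
  ... | inj₁ u | inj₁ v = Sum.map (splitAt≡inj₁⇒∈++ x≡u) (splitAt≡inj₁⇒∈++ y≡v) (proj₁ (cover xy))
  ... | inj₁ u | inj₂ v = Sum.map (splitAt≡inj₁⇒∈++ x≡u) (splitAt≡inj₂⇒∈++ y≡v) (proj₂ (cover xy))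
  ... | inj₂ u | inj₁ v = Sum.swap
    (Sum.map (splitAt≡inj₁⇒∈++ y≡v) (splitAt≡inj₂⇒∈++ x≡u) (proj₂ (cover (trans (symm G v u) xy))))
  ... | inj₂ u | inj₂ v with () ← xy

  independent⇒¬Edge : ∀ {S u v} → IsIndependent G S → u ∈ S → v ∈ S → ¬ Edge G u v
  independent⇒¬Edge indep u∈S v∈S uv with () ← trans (sym uv) (indep _ _ u∈S v∈S)

  independent⇒isSplitCover : ∀ {S} → IsIndependent G S → IsSplitCover (∁ S) (N G S)
  independent⇒isSplitCover {S} indep {u} {v} uv with u ∈? S
  ... | no u∉S = inj₁ (x∉p⇒x∈∁p u∉S) , inj₁ (x∉p⇒x∈∁p u∉S)
  ... | yes u∈S = inj₂ v∈∁S , inj₂ (∈-N⁺ u∈S uv)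
    where
    v∈∁S : v ∈ ∁ S
    v∈∁S = x∉p⇒x∈∁p (λ v∈S → independent⇒¬Edge indep u∈S v∈S uv)

  isSplitCover⇒independent∁ : ∀ {X Y} → IsSplitCover X Y → IsIndependent G (∁ X)
  isSplitCover⇒independent∁ cover u v u∈∁X v∈∁X with adj G u v in uv
  ... | false = refl
  ... | true with proj₁ (cover uv)
  ...   | inj₁ u∈X = ⊥-elim (x∈∁p⇒x∉p u∈∁X u∈X)
  ...   | inj₂ v∈X = ⊥-elim (x∈∁p⇒x∉p v∈∁X v∈X)

  isSplitCover⇒N∁⊆ : ∀ {X Y} → IsSplitCover X Y → N G (∁ X) ⊆ Y
  isSplitCover⇒N∁⊆ cover v∈N with ∈-N⁻ v∈N
  ... | u , u∈∁X , uv with proj₂ (cover uv)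
  ...   | inj₁ u∈X = ⊥-elim (x∈∁p⇒x∉p u∈∁X u∈X)
  ...   | inj₂ v∈Y = v∈Y

  difference : Subset n → ℤ
  difference S = + ∣ S ∣ - + ∣ N G S ∣

  independent⇒vertexCover : ∀ {S} → IsIndependent G S →
    ∃[ C ] IsVertexCover (SplittingGraph G) C × + ∣ C ∣ ≡ + n - difference S
  independent⇒vertexCover {S} indep =
    ∁ S ++ N G S , isSplitCover⇒vertexCover (independent⇒isSplitCover indep) , size
    where
    open ≡-Reasoning
    open +-*-Solver
    size : + ∣ ∁ S ++ N G S ∣ ≡ + n - difference S
    size = begin
      + ∣ ∁ S ++ N G S ∣                ≡⟨ cong +_ (∣p++q∣≡∣p∣+∣q∣ (∁ S) (N G S)) ⟩
      + (∣ ∁ S ∣ ℕ.+ ∣ N G S ∣)         ≡⟨ pos-+ ∣ ∁ S ∣ ∣ N G S ∣ ⟩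
      + ∣ ∁ S ∣ ℤ.+ + ∣ N G S ∣         ≡⟨ cong (ℤ._+ + ∣ N G S ∣) (+∣∁p∣≡n-∣p∣ S) ⟩
      (+ n - + ∣ S ∣) ℤ.+ + ∣ N G S ∣   ≡⟨ solve 3 (λ n s t → (n :- s) :+ t := n :- (s :- t))
                                               refl (+ n) (+ ∣ S ∣) (+ ∣ N G S ∣) ⟩
      + n - difference S                ∎

  vertexCover⇒independent : ∀ {C} → IsVertexCover (SplittingGraph G) C →
    ∃[ A ] IsIndependent G A × + n - difference A ℤ.≤ + ∣ C ∣
  vertexCover⇒independent {C} cover with Vec.splitAt n C
  ... | X , Y , refl = ∁ X , isSplitCover⇒independent∁ split , size
    where
    open ≤-Reasoning
    open +-*-Solver
    split : IsSplitCover X Y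
    split = vertexCover⇒isSplitCover cover
    size : + n - difference (∁ X) ℤ.≤ + ∣ X ++ Y ∣
    size = begin
      + n - difference (∁ X)                       ≡⟨ cong (λ c → + n - (c - + ∣ N G (∁ X) ∣)) (+∣∁p∣≡n-∣p∣ X) ⟩
      + n - ((+ n - + ∣ X ∣) - + ∣ N G (∁ X) ∣)    ≡⟨ solve 3 (λ n x t → n :- ((n :- x) :- t) := x :+ t)
                                                        refl (+ n) (+ ∣ X ∣) (+ ∣ N G (∁ X) ∣) ⟩
      + ∣ X ∣ ℤ.+ + ∣ N G (∁ X) ∣                  ≤⟨ +-monoʳ-≤ (+ ∣ X ∣) (ℤ.+≤+ (p⊆q⇒∣p∣≤∣q∣ (isSplitCover⇒N∁⊆ split))) ⟩
      + ∣ X ∣ ℤ.+ + ∣ Y ∣                          ≡⟨ pos-+ ∣ X ∣ ∣ Y ∣ ⟨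
      + (∣ X ∣ ℕ.+ ∣ Y ∣)                          ≡⟨ cong +_ (∣p++q∣≡∣p∣+∣q∣ X Y) ⟨
      + ∣ X ++ Y ∣                                 ∎

corollary1 : ∀ (n : ℕ) (G : Graph n) → 2 ≤ n → Connected G →
    ∀ (a : ℕ) (b : ℤ) → IsVertexCoverNumber (SplittingGraph G) a →
    IsBetaStar G b → + a ≡ + n - b
corollary1 n G _ _ a b ((C , C-cover , ∣C∣≡a) , a-min) ((S , S-indep , refl) , b-max) =
  ≤-antisym α₀≤n-β₀* n-β₀*≤α₀
  where
  open ≤-Reasoning
  α₀≤n-β₀* : + a ℤ.≤ + n - difference G S
  α₀≤n-β₀* with independent⇒vertexCover G S-indep
  ... | D , D-cover , ∣D∣ = begin
    + a                  ≤⟨ ℤ.+≤+ (a-min D D-cover) ⟩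
    + ∣ D ∣              ≡⟨ ∣D∣ ⟩
    + n - difference G S ∎
  n-β₀*≤α₀ : + n - difference G S ℤ.≤ + a
  n-β₀*≤α₀ with vertexCover⇒independent G C-cover
  ... | A , A-indep , bound = begin
    + n - difference G S ≤⟨ +-monoʳ-≤ (+ n) (neg-mono-≤ (b-max A A-indep)) ⟩
    + n - difference G A ≤⟨ bound ⟩
    + ∣ C ∣              ≡⟨ cong +_ ∣C∣≡a ⟩
    + a                  ∎
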